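{- Every graph in $\varepsilon_{03}$ has a node of degree $2$.
   Context: All graphs are finite, simple and connected. An Euler graph is a connected graph all of whose nodes have even degree. A cycle of length $n$ is of type $i$ if $n\equiv i\pmod 4$. $\varepsilon_{03}$ is the class of Euler graphs in which every cycle has length $\equiv 0$ or $\equiv 3\pmod 4$ and which contain at least one cycle of each of the types $0$ and $3$. -}

module Defs where

open import Data.Nat using (ℕ; zero; suc; _≤_; _%_)
open import Data.Nat.Divisibility using (_∣_)
open import Data.Bool using (Bool; true; false; if_then_else_)
open import Data.Fin using (Fin)
open import Data.List using (List; []; _∷_; _++_; length; map; allFin)
open import Data.Nat.ListAction using (sum)
open import Data.List.Relation.Unary.Unique.Propositional using (Unique)
open import Data.List.Relation.Unary.Linked using (Linked)
open import Data.Product using (Σ; ∃; _×_)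
open import Data.Sum using (_⊎_)
open import Relation.Binary.PropositionalEquality using (_≡_)

record Graph : Set where
  field
    n      : ℕ
    adj    : Fin n → Fin n → Bool
    sym    : ∀ u v → adj u v ≡ adj v u
    irrefl : ∀ v → adj v v ≡ false
open Graph public

Adj : (G : Graph) → Fin (n G) → Fin (n G) → Set
Adj G u v = adj G u v ≡ true

degree : (G : Graph) → Fin (n G) → ℕ
degree G v = sum (map (λ u → if adj G v u then 1 else 0) (allFin (n G)))

data Walk (G : Graph) : Fin (n G) → Fin (n G) → Set where
  here : ∀ {u} → Walk G u u
  step : ∀ {u w v} → Adj G u w → Walk G w v → Walk G u v

Connected : Graph → Set
Connected G = ∀ u v → Walk G u v

Euler : Graph → Set
Euler G = Connected G × (∀ v → 2 ∣ degree G v)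

-- A cycle: pairwise distinct vertices start, r₁, …, r_k (k ≥ 2, so at
-- least 3 vertices) with consecutive vertices adjacent and r_k adjacent
-- to start.
record Cycle (G : Graph) : Set where
  field
    start    : Fin (n G)
    rest     : List (Fin (n G))
    distinct : Unique (start ∷ rest)
    long     : 2 ≤ length rest
    closed   : Linked (Adj G) (start ∷ rest ++ start ∷ [])
open Cycle public

cycleLength : {G : Graph} → Cycle G → ℕ
cycleLength C = suc (length (rest C))

HasType : {G : Graph} → Cycle G → ℕ → Set
HasType C i = cycleLength C % 4 ≡ i

ε₀₃ : Graph → Set
ε₀₃ G = Euler G
      × (∀ (C : Cycle G) → HasType C 0 ⊎ HasType C 3)
      × (Σ (Cycle G) λ C → HasType C 0)
      × (Σ (Cycle G) λ C → HasType C 3)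

-- Let v be an end of a maximal path P; all neighbours of v lie on P. Two of them
-- at distance d along P, together with v, span a cycle of length d + 2, so
-- d ≡ 1 or 2 (mod 4). If v had four neighbours, at consecutive distances a, b, c
-- along P, then a, b, a + b force a ≡ b ≡ 1, so a + b ≡ 2 (mod 4); but a + b, c
-- and a + b + c cannot all be ≡ 1 or 2. Hence v has at most three neighbours,
-- and its degree, being even, positive and below 4, is 2.
module Submission where

open import Defs
open import Data.Bool using (Bool; true; false; if_then_else_)
open import Data.Bool.Properties using (T-≡) renaming (_≟_ to _≟ᵇ_)
open import Data.Fin using (Fin)
open import Data.Fin.Properties using (any?) renaming (_≟_ to _≟ᶠ_)
open import Data.List using (List; []; _∷_; _++_; _∷ʳ_; length; map; filterᵇ; allFin)
open import Data.List.Properties using (length-++; length-++-sucʳ; ++-assoc; length-tabulate)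
open import Data.List.Membership.Propositional using (_∈_)
open import Data.List.Membership.Propositional.Properties
  using (∈-∃++; ∈-++⁻; ∈-++⁺ˡ; ∈-++⁺ʳ; ∈-filter⁺; ∈-filter⁻; ∈-allFin)
open import Data.List.Relation.Binary.Subset.Propositional using (_⊆_)
open import Data.List.Relation.Unary.All as All using (All; []; _∷_)
import Data.List.Relation.Unary.All.Properties as Allₚ
open import Data.List.Relation.Unary.AllPairs using (AllPairs; []; _∷_)
open import Data.List.Relation.Unary.Any using (here; there)
open import Data.List.Relation.Unary.Linked as Linked using (Linked; []; [-]; _∷_)
open import Data.List.Relation.Unary.Unique.Propositional using (Unique)
open import Data.List.Relation.Unary.Unique.Propositional.Properties using (allFin⁺; filter⁺)
open import Data.Nat using (ℕ; zero; suc; _+_; _≤_; _<_; z≤n; s≤s; s≤s⁻¹; _%_)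
open import Data.Nat.Properties
  using (≤-trans; ≤-reflexive; ≤-<-trans; <⇒≱; ≰⇒>; +-comm; +-suc; +-identityʳ; m≤m+n; m<n+m)
open import Data.Nat.DivMod using (%-distribˡ-+; m%n<n)
open import Data.Nat.Divisibility using (_∣_; divides)
open import Data.Nat.ListAction using (sum)
open import Data.Product using (Σ; ∃; ∃₂; ∃-syntax; _×_; _,_; proj₁; proj₂)
open import Data.Sum using (_⊎_; inj₁; inj₂; [_,_]′)
open import Function using (id; _∘_)
open import Function.Bundles using (Equivalence)
open import Relation.Binary.PropositionalEquality as ≡ using (_≡_; refl; cong; subst)
open import Relation.Nullary using (¬_; yes; no; contradiction)
open import Relation.Nullary.Decidable using (_×-dec_; T?)

ZeroOrThreeMod4 : ℕ → Set
ZeroOrThreeMod4 m = m % 4 ≡ 0 ⊎ m % 4 ≡ 3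

OneOrTwoMod4 : ℕ → Set
OneOrTwoMod4 d = d % 4 ≡ 1 ⊎ d % 4 ≡ 2

%4-distrib-+ : ∀ a b → (a + b) % 4 ≡ (a % 4 + b % 4) % 4
%4-distrib-+ a b = %-distribˡ-+ a b 4

zeroOrThree⇒oneOrTwo : ∀ d → ZeroOrThreeMod4 (2 + d) → OneOrTwoMod4 d
zeroOrThree⇒oneOrTwo d t rewrite %4-distrib-+ 2 d with d % 4 | m%n<n d 4
... | 0 | _ = [ (λ ()) , (λ ()) ]′ t
... | 1 | _ = inj₁ refl
... | 2 | _ = inj₂ refl
... | 3 | _ = [ (λ ()) , (λ ()) ]′ t
... | suc (suc (suc (suc _))) | s≤s (s≤s (s≤s (s≤s ())))

oneOrTwo-+ : ∀ a b → OneOrTwoMod4 a → OneOrTwoMod4 b → OneOrTwoMod4 (a + b) →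
             a % 4 ≡ 1 × b % 4 ≡ 1
oneOrTwo-+ a b ra rb rab rewrite %4-distrib-+ a b with a % 4 | b % 4
oneOrTwo-+ a b (inj₁ refl) (inj₁ refl) _   | _ | _ = refl , refl
oneOrTwo-+ a b (inj₁ refl) (inj₂ refl) rab | _ | _ = [ (λ ()) , (λ ()) ]′ rab
oneOrTwo-+ a b (inj₂ refl) (inj₁ refl) rab | _ | _ = [ (λ ()) , (λ ()) ]′ rab
oneOrTwo-+ a b (inj₂ refl) (inj₂ refl) rab | _ | _ = [ (λ ()) , (λ ()) ]′ rab

oneOrTwo-chain : ∀ a b c → OneOrTwoMod4 a → OneOrTwoMod4 b → OneOrTwoMod4 c →
                 OneOrTwoMod4 (a + b) → ¬ OneOrTwoMod4 (a + b + c)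
oneOrTwo-chain a b c ra rb rc rab rabc with oneOrTwo-+ a b ra rb rab | oneOrTwo-+ (a + b) c rab rc rabc
... | a≡1 , b≡1 | ab≡1 , _ = contradiction (≡.trans (≡.sym ab≡1) ab≡2) λ ()
  where
  ab≡2 : (a + b) % 4 ≡ 2
  ab≡2 = ≡.trans (%4-distrib-+ a b) (≡.cong₂ (λ r s → (r + s) % 4) a≡1 b≡1)

module _ {A : Set} where

  AllPairs-++⁻ˡ : ∀ {R : A → A → Set} xs {ys} → AllPairs R (xs ++ ys) → AllPairs R xs
  AllPairs-++⁻ˡ []       _          = []
  AllPairs-++⁻ˡ (x ∷ xs) (px ∷ pxs) = Allₚ.++⁻ˡ xs px ∷ AllPairs-++⁻ˡ xs pxs

  AllPairs-++⁻ʳ : ∀ {R : A → A → Set} xs {ys} → AllPairs R (xs ++ ys) → AllPairs R ys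
  AllPairs-++⁻ʳ []       pxs       = pxs
  AllPairs-++⁻ʳ (x ∷ xs) (_ ∷ pxs) = AllPairs-++⁻ʳ xs pxs

  Linked-++⁻ˡ : ∀ {R : A → A → Set} xs {ys} → Linked R (xs ++ ys) → Linked R xs
  Linked-++⁻ˡ []           _         = []
  Linked-++⁻ˡ (x ∷ [])     _         = [-]
  Linked-++⁻ˡ (x ∷ y ∷ xs) (r ∷ rxs) = r ∷ Linked-++⁻ˡ (y ∷ xs) rxs

  Linked-++⁻ʳ : ∀ {R : A → A → Set} xs {ys} → Linked R (xs ++ ys) → Linked R ys
  Linked-++⁻ʳ []       rys = rys
  Linked-++⁻ʳ (x ∷ xs) rxs = Linked-++⁻ʳ xs (Linked.tail rxs)

  Linked-∷ʳ⁺ : ∀ {R : A → A → Set} xs {x y} → Linked R (xs ∷ʳ x) → R x y → Linked R (xs ∷ʳ x ∷ʳ y)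
  Linked-∷ʳ⁺ []           _         rxy = rxy ∷ [-]
  Linked-∷ʳ⁺ (_ ∷ [])     (r ∷ _)   rxy = r ∷ rxy ∷ [-]
  Linked-∷ʳ⁺ (_ ∷ z ∷ xs) (r ∷ rxs) rxy = r ∷ Linked-∷ʳ⁺ (z ∷ xs) rxs rxy

  ∈-++-∷⁻ : ∀ {x y : A} xs {ys} → y ∈ xs ++ x ∷ ys → ¬ y ≡ x → y ∈ xs ++ ys
  ∈-++-∷⁻ xs y∈ y≢x with ∈-++⁻ xs y∈
  ... | inj₁ y∈xs         = ∈-++⁺ˡ y∈xs
  ... | inj₂ (here y≡x)   = contradiction y≡x y≢x
  ... | inj₂ (there y∈ys) = ∈-++⁺ʳ xs y∈ys

  Unique-⊆⇒length≤ : ∀ {xs ys : List A} → Unique xs → xs ⊆ ys → length xs ≤ length ys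
  Unique-⊆⇒length≤ {[]}     _           _  = z≤n
  Unique-⊆⇒length≤ {x ∷ xs} (x∉xs ∷ u) xs⊆ys with ∈-∃++ (xs⊆ys (here refl))
  ... | ys₁ , ys₂ , refl =
    ≤-trans (s≤s (Unique-⊆⇒length≤ u xs⊆ys₁ys₂)) (≤-reflexive (≡.sym (length-++-sucʳ ys₁ x ys₂)))
    where
    xs⊆ys₁ys₂ : xs ⊆ ys₁ ++ ys₂
    xs⊆ys₁ys₂ y∈xs = ∈-++-∷⁻ ys₁ (xs⊆ys (there y∈xs)) (λ y≡x → All.lookup x∉xs y∈xs (≡.sym y≡x))

  count : (A → Bool) → List A → ℕ
  count p xs = length (filterᵇ p xs)

  sum-indicator≡count : ∀ (p : A → Bool) xs → sum (map (λ x → if p x then 1 else 0) xs) ≡ count p xs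
  sum-indicator≡count p []       = refl
  sum-indicator≡count p (x ∷ xs) with p x
  ... | true  = cong suc (sum-indicator≡count p xs)
  ... | false = sum-indicator≡count p xs

  count-mono : ∀ (p : A → Bool) {xs ys} → Unique xs → (∀ {x} → x ∈ xs → p x ≡ true → x ∈ ys) →
               count p xs ≤ count p ys
  count-mono p u sub = Unique-⊆⇒length≤ (filter⁺ (T? ∘ p) u) λ x∈ →
    let x∈xs , px = ∈-filter⁻ (T? ∘ p) x∈ in
    ∈-filter⁺ (T? ∘ p) (sub x∈xs (Equivalence.to T-≡ px)) px

  count>0 : ∀ (p : A → Bool) {x xs} → x ∈ xs → p x ≡ true → 0 < count p xs
  count>0 p {xs = xs} x∈ px with filterᵇ p xs | ∈-filter⁺ (T? ∘ p) x∈ (Equivalence.from T-≡ px)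
  ... | _ ∷ _ | _ = s≤s z≤n

  split-at-count : ∀ (p : A → Bool) {k} xs → suc k ≤ count p xs →
                   ∃[ ys ] ∃[ x ] ∃[ zs ] xs ≡ ys ++ x ∷ zs × p x ≡ true × k ≤ count p zs
  split-at-count p []       ()
  split-at-count p (x ∷ xs) k< with p x in px
  ... | true  = [] , x , xs , refl , px , s≤s⁻¹ k<
  ... | false with split-at-count p xs k<
  ...   | ys , y , zs , refl , py , k≤ = x ∷ ys , y , zs , refl , py , k≤

even-pos-<4⇒≡2 : ∀ {d} → 2 ∣ d → 0 < d → d < 4 → d ≡ 2
even-pos-<4⇒≡2 (divides 0             refl) ()
even-pos-<4⇒≡2 (divides 1             refl) _ _ = refl
even-pos-<4⇒≡2 (divides (suc (suc q)) refl) _ (s≤s (s≤s (s≤s (s≤s ()))))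

module _ (G : Graph) where

  private
    V : Set
    V = Fin (n G)

  open import Data.List.Membership.DecPropositional (_≟ᶠ_ {n G}) using (_∈?_; _∉?_)

  Adj-sym : ∀ {u v} → Adj G u v → Adj G v u
  Adj-sym {u} {v} = ≡.trans (Graph.sym G v u)

  Adj-irrefl : ∀ {u v} → Adj G u v → ¬ u ≡ v
  Adj-irrefl {u} uv refl with ≡.trans (≡.sym uv) (irrefl G u)
  ... | ()

  degree≡count : ∀ v → degree G v ≡ count (adj G v) (allFin (n G))
  degree≡count v = sum-indicator≡count (adj G v) (allFin (n G))

  degree>0 : ∀ {v u} → Adj G v u → 0 < degree G v
  degree>0 {v} {u} vu = ≤-trans (count>0 (adj G v) (∈-allFin u) vu) (≤-reflexive (≡.sym (degree≡count v)))

  degree≤count : ∀ {v P} → (∀ {x} → Adj G v x → x ∈ P) → degree G v ≤ count (adj G v) P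
  degree≤count {v} N⊆P =
    ≤-trans (≤-reflexive (degree≡count v)) (count-mono (adj G v) (allFin⁺ (n G)) λ _ → N⊆P)

  Unique⇒length≤n : ∀ {P : List V} → Unique P → length P ≤ n G
  Unique⇒length≤n u = ≤-trans (Unique-⊆⇒length≤ u (λ {x} _ → ∈-allFin x)) (≤-reflexive (length-tabulate id))

  ApexPath : V → List V → Set
  ApexPath v P = Unique (v ∷ P) × Linked (Adj G) P

  ApexPath-++⁻ˡ : ∀ {v} P {Q} → ApexPath v (P ++ Q) → ApexPath v P
  ApexPath-++⁻ˡ P (v∉ ∷ u , l) = Allₚ.++⁻ˡ P v∉ ∷ AllPairs-++⁻ˡ P u , Linked-++⁻ˡ P l

  ApexPath-++⁻ʳ : ∀ {v} P {Q} → ApexPath v (P ++ Q) → ApexPath v Q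
  ApexPath-++⁻ʳ P (v∉ ∷ u , l) = Allₚ.++⁻ʳ P v∉ ∷ AllPairs-++⁻ʳ P u , Linked-++⁻ʳ P l

  ApexPath-reassoc : ∀ {v x y} S S′ T →
                     ApexPath v (x ∷ S ++ y ∷ S′ ++ T) → ApexPath v (x ∷ (S ++ y ∷ S′) ++ T)
  ApexPath-reassoc {v} {x} {y} S S′ T = subst (ApexPath v) (cong (x ∷_) (≡.sym (++-assoc S (y ∷ S′) T)))

  chord-cycle : ∀ {v x y} S T → ApexPath v (x ∷ S ++ y ∷ T) → Adj G v x → Adj G v y →
                Σ (Cycle G) λ C → cycleLength C ≡ 3 + length S
  chord-cycle {v} {x} {y} S T p vx vy = C , cong suc len
    where
    segment : ApexPath v (x ∷ S ∷ʳ y)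
    segment = ApexPath-++⁻ˡ (x ∷ S ∷ʳ y) (subst (ApexPath v) (≡.sym (++-assoc (x ∷ S) (y ∷ []) T)) p)
    len : length (x ∷ S ∷ʳ y) ≡ 2 + length S
    len = cong suc (≡.trans (length-++ S) (+-comm (length S) 1))
    C : Cycle G
    C = record
      { start    = v
      ; rest     = x ∷ S ∷ʳ y
      ; distinct = proj₁ segment
      ; long     = subst (2 ≤_) (≡.sym len) (m≤m+n 2 (length S))
      ; closed   = vx ∷ Linked-∷ʳ⁺ (x ∷ S) (proj₂ segment) (Adj-sym vy)
      }

  record MaximalPath : Set where
    field
      end       : V
      body      : List V
      unique    : Unique (end ∷ body)
      linked    : Linked (Adj G) (end ∷ body)
      neighbour : ∃ (Adj G end)
      maximal   : ∀ {x} → Adj G end x → x ∈ body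

  extend : ∀ fuel v P → Unique (v ∷ P) → Linked (Adj G) (v ∷ P) → ∃ (Adj G v) →
           n G < length (v ∷ P) + fuel → MaximalPath
  extend zero v P u _ _ n< =
    contradiction (Unique⇒length≤n u) (<⇒≱ (subst (n G <_) (+-identityʳ _) n<))
  extend (suc fuel) v P u l e n< with any? (λ x → (adj G v x ≟ᵇ true) ×-dec (x ∉? v ∷ P))
  ... | yes (x , vx , x∉) =
    extend fuel x (v ∷ P) (Allₚ.¬Any⇒All¬ (v ∷ P) x∉ ∷ u) (Adj-sym vx ∷ l) (v , Adj-sym vx)
           (subst (n G <_) (+-suc _ fuel) n<)
  ... | no ∄ = record { end = v ; body = P ; unique = u ; linked = l ; neighbour = e ; maximal = maximal }
    where
    maximal : ∀ {x} → Adj G v x → x ∈ P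
    maximal {x} vx with x ∈? v ∷ P
    ... | yes (here refl) = contradiction refl (Adj-irrefl vx)
    ... | yes (there x∈P) = x∈P
    ... | no x∉           = contradiction (x , vx , x∉) ∄

  maximal-path : ∃₂ (Adj G) → MaximalPath
  maximal-path (u , v , uv) =
    extend (n G) u (v ∷ []) ((Adj-irrefl uv ∷ []) ∷ [] ∷ []) (uv ∷ [-]) (v , uv) (m<n+m (n G) (s≤s z≤n))

  Cycle⇒edge : Cycle G → ∃₂ (Adj G)
  Cycle⇒edge C with rest C | long C | closed C
  ... | u ∷ _ | _ | su ∷ _ = start C , u , su

  module _ (types : ∀ (C : Cycle G) → HasType C 0 ⊎ HasType C 3) where

    -- Neighbours x, y of v at distance d along P close a cycle of length d + 2.
    chord-gap : ∀ {v x y} S T → ApexPath v (x ∷ S ++ y ∷ T) → Adj G v x → Adj G v y →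
                OneOrTwoMod4 (suc (length S))
    chord-gap S T p vx vy with C , len ← chord-cycle S T p vx vy =
      zeroOrThree⇒oneOrTwo (suc (length S)) (subst ZeroOrThreeMod4 len (types C))

    chord-gap-++ : ∀ {v x y z} S S′ T → ApexPath v (x ∷ S ++ y ∷ S′ ++ z ∷ T) →
                   Adj G v x → Adj G v z → OneOrTwoMod4 (suc (length S) + suc (length S′))
    chord-gap-++ S S′ T p vx vz =
      subst OneOrTwoMod4 (cong suc (length-++ S)) (chord-gap (S ++ _ ∷ S′) T (ApexPath-reassoc S S′ _ p) vx vz)

    ¬4≤neighbours-on-path : ∀ {v} P → ApexPath v P → ¬ 4 ≤ count (adj G v) P
    ¬4≤neighbours-on-path {v} P p 4≤ with split-at-count (adj G v) P 4≤
    ... | A , x₁ , Q₁ , refl , vx₁ , 3≤ with split-at-count (adj G v) Q₁ 3≤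
    ... | S₁ , x₂ , Q₂ , refl , vx₂ , 2≤ with split-at-count (adj G v) Q₂ 2≤
    ... | S₂ , x₃ , Q₃ , refl , vx₃ , 1≤ with split-at-count (adj G v) Q₃ 1≤
    ... | S₃ , x₄ , R  , refl , vx₄ , _  =
      oneOrTwo-chain (suc (length S₁)) (suc (length S₂)) (suc (length S₃))
        (chord-gap S₁ _ p₁ vx₁ vx₂) (chord-gap S₂ _ p₂ vx₂ vx₃) (chord-gap S₃ R p₃ vx₃ vx₄)
        (chord-gap-++ S₁ S₂ _ p₁ vx₁ vx₃) gap₁₄
      where
      p₁ : ApexPath v (x₁ ∷ S₁ ++ x₂ ∷ S₂ ++ x₃ ∷ S₃ ++ x₄ ∷ R)
      p₁ = ApexPath-++⁻ʳ A p
      p₂ : ApexPath v (x₂ ∷ S₂ ++ x₃ ∷ S₃ ++ x₄ ∷ R)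
      p₂ = ApexPath-++⁻ʳ (x₁ ∷ S₁) p₁
      p₃ : ApexPath v (x₃ ∷ S₃ ++ x₄ ∷ R)
      p₃ = ApexPath-++⁻ʳ (x₂ ∷ S₂) p₂
      gap₁₄ : OneOrTwoMod4 (suc (length S₁) + suc (length S₂) + suc (length S₃))
      gap₁₄ = subst (λ m → OneOrTwoMod4 (m + suc (length S₃))) (cong suc (length-++ S₁))
                (chord-gap-++ (S₁ ++ x₂ ∷ S₂) S₃ R (ApexPath-reassoc S₁ S₂ _ p₁) vx₁ vx₄)

theorem11 : (G : Graph) → ε₀₃ G → ∃ λ v → degree G v ≡ 2
theorem11 G ((_ , even) , types , (C , _) , _) =
  end , even-pos-<4⇒≡2 (even end) (degree>0 G (proj₂ neighbour)) degree<4
  where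
  open MaximalPath (maximal-path G (Cycle⇒edge G C))
  degree<4 : degree G end < 4
  degree<4 = ≤-<-trans (degree≤count G maximal)
                       (≰⇒> (¬4≤neighbours-on-path G types body (unique , Linked.tail linked)))
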